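{- Let $q$ be a prime power and let $M$ be a simple $GF(q)$-representable matroid, viewed as a spanning restriction of $\overline{M}_q=PG(r(M)-1,q)$. Let $(T,\tau)$ be a tree-decomposition of $M$ with width $\mathrm{tw}(M)$, and let $S$ be a subset of the external neck (with respect to $\overline{M}_q$) of an edge of $T$. Then $\mathrm{tw}(M)=\mathrm{tw}(M^S)$.
   Context: Matroid tree-width: a tree-decomposition of $M$ is a pair $(T,\tau)$ with $T$ a tree and $\tau:E(M)\to V(T)$ an arbitrary map. For a vertex $v$ of $T$, let $T_1,\dots,T_c$ be the components of $T-v$ and $B_j=\{e\in E(M):\tau(e)\in V(T_j)\}$. The rank defect of a set $B$ is $\mathrm{rd}(B)=r(M)-r(E(M)-B)$. The node width of $v$ is $r(M)-\sum_{j=1}^{c}\mathrm{rd}(B_j)$ (equal to $r(M)$ if $T$ has one vertex). The width of $(T,\tau)$ is the maximum node width over the vertices of $T$, and $\mathrm{tw}(M)$ is the minimum width over all tree-decompositions of $M$. For a simple $GF(q)$-representable matroid $M$, $\overline{M}_q$ denotes the projective geometry $PG(r(M)-1,q)$ of which $M$ is a spanning restriction; for $S\subseteq E(\overline{M}_q)-E(M)$, $M^S$ denotes the restriction of $\overline{M}_q$ to $E(M)\cup S$. For an edge $uw$ of $T$, let $U',W'\subseteq E(M)$ be the sets of elements mapped by $\tau$ into the components of $T\setminus uw$ containing $u$ and $w$ respectively; the neck of $uw$ is $\mathrm{cl}_{\overline{M}_q}(U')\cap\mathrm{cl}_{\overline{M}_q}(W')$, and the external neck of $uw$ is the neck of $uw$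 intersected with $E(\overline{M}_q)-E(M)$. -}

module Defs where

open import Level using (0ℓ)
open import Data.Nat using (ℕ; zero; suc; _∸_; _⊔_; _^_; _≤_)
open import Data.Nat.Primality using (Prime)
open import Data.Bool using (Bool; true; false; not)
open import Data.Fin using (Fin; zero; suc; toℕ)
open import Data.Fin.Properties using (all?) renaming (_≟_ to _≟ᶠ_)
open import Data.Fin.Subset using (Subset; inside; outside; _∈_; _∉_; _⊆_; ∣_∣; ⊤)
open import Data.Fin.Subset.Properties using (_∈?_; _⊆?_)
open import Data.Vec using (Vec; []; _∷_; lookup; zipWith; replicate; tabulate)
import Data.Vec as Vec
open import Data.Vec.Properties using (≡-dec)
import Data.Vec.Functional as VF
open import Data.List using (List; []; _∷_; [_]; _++_; map; filter; foldr; allFin)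
import Data.List.Membership.DecPropositional as ListMem
open import Data.Product using (Σ; ∃; ∃-syntax; _×_; _,_; proj₁)
open import Algebra.Core using (Op₁; Op₂)
open import Algebra.Structures using (IsCommutativeRing)
open import Function using (_∘_; _↔_)
open import Function.Bundles using (Inverse)
open import Relation.Nullary using (¬_; Dec; yes; no; _×-dec_; _→-dec_; ¬?; map′; does)
open import Relation.Binary.PropositionalEquality using (_≡_; _≢_; refl; subst)
open import Relation.Binary.Definitions using (DecidableEquality)

IsPrimePower : ℕ → Set
IsPrimePower q = ∃[ p ] ∃[ k ] (Prime p × q ≡ p ^ suc k)

record FiniteField (q : ℕ) : Set₁ where
  infixl 7 _*_
  infixl 6 _+_
  field
    Carrier           : Set
    _+_ _*_           : Op₂ Carrier
    -_                : Op₁ Carrier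
    0# 1#             : Carrier
    isCommutativeRing : IsCommutativeRing _≡_ _+_ _*_ -_ 0# 1#
    0≢1               : 0# ≢ 1#
    inverse           : ∀ x → x ≢ 0# → ∃[ y ] (x * y ≡ 1#)
    enumeration       : Fin q ↔ Carrier

module GF {q : ℕ} (𝔽 : FiniteField q) where
  open FiniteField 𝔽

  F : Set
  F = Carrier

  _≟F_ : DecidableEquality F
  x ≟F y with Inverse.from enumeration x ≟ᶠ Inverse.from enumeration y
  ... | yes p = yes (subst (λ z → z ≡ y)
                       (Inverse.inverseˡ enumeration {x} refl)
                       (subst (λ i → Inverse.to enumeration i ≡ y) (sym' p)
                              (Inverse.inverseˡ enumeration {y} refl)))
    where
    sym' : ∀ {A : Set} {a b : A} → a ≡ b → b ≡ a
    sym' refl = refl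
  ... | no ¬p = no (λ { refl → ¬p refl })

  ∀F? : {P : F → Set} → (∀ x → Dec (P x)) → Dec (∀ x → P x)
  ∀F? {P} P? with all? (λ i → P? (Inverse.to enumeration i))
  ... | yes h = yes (λ x → subst P (Inverse.inverseˡ enumeration {x} refl)
                                   (h (Inverse.from enumeration x)))
  ... | no ¬h = no (λ h → ¬h (λ i → h (Inverse.to enumeration i)))

  ∀Vec? : ∀ n {P : Vec F n → Set} → (∀ v → Dec (P v)) → Dec (∀ v → P v)
  ∀Vec? zero    P? = map′ (λ p → λ { [] → p }) (λ h → h []) (P? [])
  ∀Vec? (suc n) P? = map′ (λ h → λ { (x ∷ v) → h x v }) (λ h x v → h (x ∷ v))
                          (∀F? (λ x → ∀Vec? n (λ v → P? (x ∷ v))))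

  0v : ∀ {r} → Vec F r
  0v = replicate _ 0#

  _⊕_ : ∀ {r} → Vec F r → Vec F r → Vec F r
  _⊕_ = zipWith _+_

  _·_ : ∀ {r} → F → Vec F r → Vec F r
  a · v = Vec.map (a *_) v

  lincomb : ∀ {r n} → Vec F n → (Fin n → Vec F r) → Vec F r
  lincomb []       v = 0v
  lincomb (c ∷ cs) v = (c · v zero) ⊕ lincomb cs (v ∘ suc)

  -- Points of PG(r-1,q): one-dimensional subspaces of F^r, represented by
  -- their unique normalised spanning vector (first nonzero coordinate = 1).
  data Normalized : ∀ {r} → Vec F r → Set where
    lead : ∀ {r} (v : Vec F r) → Normalized (1# ∷ v)
    skip : ∀ {r} {v : Vec F r} → Normalized v → Normalized (0# ∷ v)

  -- The vector matroid of a family v : Fin n → F^r.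

  Indep : ∀ {r n} → (Fin n → Vec F r) → Subset n → Set
  Indep {r} {n} v Y =
    (c : Vec F n) → (∀ i → i ∉ Y → lookup c i ≡ 0#) → lincomb c v ≡ 0v →
    ∀ i → lookup c i ≡ 0#

  indep? : ∀ {r n} (v : Fin n → Vec F r) (Y : Subset n) → Dec (Indep v Y)
  indep? {r} {n} v Y = ∀Vec? n (λ c →
      all? (λ i → ¬? (i ∈? Y) →-dec (lookup c i ≟F 0#))
    →-dec (≡-dec _≟F_ (lincomb c v) 0v
    →-dec all? (λ i → lookup c i ≟F 0#)))

  allSubsets : ∀ n → List (Subset n)
  allSubsets zero    = [ [] ]
  allSubsets (suc n) = map (outside ∷_) (allSubsets n) ++ map (inside ∷_) (allSubsets n)

  maxL : List ℕ → ℕ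
  maxL = foldr _⊔_ 0

  rank : ∀ {r n} → (Fin n → Vec F r) → Subset n → ℕ
  rank {r} {n} v X = maxL (map ∣_∣ (filter good? (allSubsets n)))
    where
    good? : (Y : Subset n) → Dec (Y ⊆ X × Indep v Y)
    good? Y = (Y ⊆? X) ×-dec indep? v Y

  rankM : ∀ {r n} → (Fin n → Vec F r) → ℕ
  rankM v = rank v ⊤

  InClosure : ∀ {r n} → (Fin n → Vec F r) → Subset n → Vec F r → Set
  InClosure v X p = rank (p VF.∷ v) (inside ∷ X) ≡ rank v X

-- Vertices are Fin (suc k); vertex 0 is a root and vertex
-- (suc i) has parent (par i) with toℕ (par i) ≤ toℕ i (i.e. parents have
-- smaller labels).  Every finite tree is isomorphic to such a tree; the
-- edges are exactly { suc i , par i } for i : Fin k.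

record Tree : Set where
  field
    k    : ℕ
    par  : Fin k → Fin (suc k)
    par< : ∀ i → toℕ (par i) ≤ toℕ i

module TreeOps (T : Tree) where
  open Tree T

  V : Set
  V = Fin (suc k)

  open ListMem (_≟ᶠ_ {suc k}) using () renaming (_∈?_ to _∈ₗ?_)

  -- w together with its ancestors (fuel suc k suffices: depth ≤ k)
  ancestors : ℕ → V → List V
  ancestors zero       w       = w ∷ []
  ancestors (suc fuel) zero    = zero ∷ []
  ancestors (suc fuel) (suc i) = suc i ∷ ancestors fuel (par i)

  below : V → V → Bool
  below u w = does (u ∈ₗ? ancestors (suc k) w)

  -- The components of T - v are in bijection with the neighbours of v:
  -- for each child c of v, the subtree of c; and, if v ≠ root, the set of
  -- vertices not in the subtree of v (the component containing v's parent).
  components : V → List (V → Bool)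
  components v = map (λ c → below c) children ++ parentSide v
    where
    children : List V
    children = map suc (filter (λ i → par i ≟ᶠ v) (allFin k))
    parentSide : V → List (V → Bool)
    parentSide zero    = []
    parentSide (suc _) = (λ w → not (below v w)) ∷ []

  -- The two sides of the edge e_i = {suc i, par i} in T \ e_i:
  -- side of suc i = subtree of suc i; side of par i = the rest.
  childSide : Fin k → V → Bool
  childSide i w = below (suc i) w

  parentSide' : Fin k → V → Bool
  parentSide' i w = not (below (suc i) w)

record TreeDec (n : ℕ) : Set where
  field
    tree : Tree
    τ    : Fin n → Fin (suc (Tree.k tree))

module _ {q : ℕ} (𝔽 : FiniteField q) where
  open GF 𝔽
  open Tree

  preimage : ∀ {n} (D : TreeDec n) → (Fin (suc (k (TreeDec.tree D))) → Bool) → Subset n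
  preimage D P = tabulate (λ x → P (TreeDec.τ D x))

  complement : ∀ {n} → Subset n → Subset n
  complement = Vec.map not

  rankDefect : ∀ {r n} → (Fin n → Vec F r) → Subset n → ℕ
  rankDefect v B = rankM v ∸ rank v (complement B)

  -- node width of v = r(M) - Σ_j rd(B_j)
  -- (Σ_j rd(B_j) ≤ r(M) always holds by submodularity, so ∸ is exact)
  nodeWidth : ∀ {r n} → (Fin n → Vec F r) → (D : TreeDec n) →
              Fin (suc (k (TreeDec.tree D))) → ℕ
  nodeWidth e D v =
    rankM e ∸ foldr Data.Nat._+_ 0
      (map (λ C → rankDefect e (preimage D C)) (TreeOps.components (TreeDec.tree D) v))

  width : ∀ {r n} → (Fin n → Vec F r) → TreeDec n → ℕ
  width e D = maxL (map (nodeWidth e D) (allFin (suc (k (TreeDec.tree D)))))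

  InNeck : ∀ {r n} → (Fin n → Vec F r) → (D : TreeDec n) →
           Fin (k (TreeDec.tree D)) → Vec F r → Set
  InNeck e D i p =
    InClosure e (preimage D (TreeOps.childSide (TreeDec.tree D) i)) p ×
    InClosure e (preimage D (TreeOps.parentSide' (TreeDec.tree D) i)) p

  InExternalNeck : ∀ {r n} → (Fin n → Vec F r) → (D : TreeDec n) →
                   Fin (k (TreeDec.tree D)) → Vec F r → Set
  InExternalNeck e D i p = InNeck e D i p × (∀ x → e x ≢ p)

-- Let u be the endpoint farther from the root of the edge whose neck contains S. Sending every point of S
-- to u turns (T, τ) into a decomposition of M^S. For a vertex v of T, each component C of T - v either
-- contains u, so the points of S stay out of E - B_C, or lies on one side of the edge, so that the other
-- side is contained in E - B_C and S lies in the closure of E - B_C. Adding S therefore changes neither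
-- r(M) nor any r(E - B_C), and the width does not grow: tw(M^S) ≤ tw(M). Conversely, restricting any
-- decomposition of M^S to E(M) can only lower the ranks r(E - B_C) while r(M^S) = r(M), so tw(M) ≤ tw(M^S).
-- The closure facts rest on rank being the size of every maximal independent set, which is the Steinitz
-- exchange lemma.
module Submission where

open import Algebra.Bundles using (CommutativeRing)
import Algebra.Properties.CommutativeSemigroup as CommutativeSemigroupProperties
import Algebra.Properties.Ring as RingProperties
open import Data.Bool using (Bool; true; false; not)
open import Data.Bool.Properties using (not-injective; ¬-not)
open import Data.Empty using (⊥-elim)
open import Data.Fin using (Fin; zero; suc; toℕ; _↑ˡ_; _↑ʳ_; splitAt)
open import Data.Fin.Properties using (all?; any?; toℕ≤n) renaming (_≟_ to _≟ᶠ_)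
open import Data.Fin.Subset using (Subset; inside; outside; _∈_; _∉_; _⊆_; ∣_∣; ⁅_⁆; _∪_; _-_; ⊤; ⊥)
open import Data.Fin.Subset.Properties
  using ( ∈⊤; ∉⊥; _∈?_; _⊆?_; ⊥⊆; nonempty?; Empty-unique; ∣⊥∣≡0; x∈p∪q⁻; x∈⁅y⁆⇒x≡y; x∈p∧x≢y⇒x∈p-y
        ; p─q⊆p; drop-∷-⊆; p─⊥≡p; ∪-identityʳ; ∣p─q∣≤∣p∣; x∈p⇒∣p-x∣<∣p∣ )
open import Data.List as List using (filter)
import Data.List.Membership.DecPropositional as DecMembership
open import Data.List.Membership.Propositional using () renaming (_∈_ to _∈ₗ_)
open import Data.List.Membership.Propositional.Properties
  using (∈-map⁺; ∈-map⁻; ∈-filter⁺; ∈-filter⁻; foldr-selective)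
  renaming (∈-++⁺ˡ to ∈ₗ-++⁺ˡ; ∈-++⁺ʳ to ∈ₗ-++⁺ʳ)
open import Data.List.Relation.Unary.All as All using (All; [])
open import Data.List.Relation.Unary.All.Properties using (++⁺; map⁺)
open import Data.List.Relation.Unary.Any using (here; there)
open import Data.Nat using (ℕ; zero; suc; _≤_; z≤n; s≤s)
import Data.Nat as ℕ using (_+_)
import Data.Nat.Properties as ℕ
open import Data.Product using (∃-syntax; _×_; _,_; proj₁; proj₂)
open import Data.Sum using (_⊎_; inj₁; inj₂; [_,_]′)
open import Data.Sum.Properties using ([,]-map)
open import Data.Unit using (tt)
open import Data.Vec using (Vec; []; _∷_; lookup; tabulate; _[_]≔_; here; there)
import Data.Vec as Vec
open import Data.Vec.Properties
  using ( lookup-zipWith; lookup-map; lookup-replicate; lookup∘tabulate; lookup∘updateAt; lookup∘updateAt′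
        ; lookup-++ˡ; lookup-++ʳ; []=⇒lookup; lookup⇒[]=; map-++; tabulate-cong; ≡-dec )
import Data.Vec.Relation.Binary.Pointwise.Extensional as Extensional
open import Data.Vec.Relation.Binary.Pointwise.Inductive
  using (zipWith-assoc; zipWith-comm; zipWith-identityˡ; Pointwise-≡⇒≡)
open import Data.Vec.Functional using (_++_)
import Data.Vec.Functional as VF
import Data.Vec.Functional.Properties as VF
open import Function using (_∘_)
open import Function.Bundles using (Inverse)
open import Relation.Binary.PropositionalEquality
open import Relation.Nullary using (¬_; Dec; yes; no; proof; ¬?; _×-dec_; _→-dec_)
open import Relation.Nullary.Decidable using (map′; dec-true; dec-false)
open import Relation.Nullary.Reflects using (Reflects; invert)

open import Defs

x∉p-x : ∀ {n} (p : Subset n) x → x ∉ p - x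
x∉p-x (inside  ∷ p) zero    ()
x∉p-x (outside ∷ p) zero    ()
x∉p-x (_       ∷ p) (suc x) (there x∈) = x∉p-x p x x∈

∣p∣≡1+∣p-x∣ : ∀ {n} {p : Subset n} {x} → x ∈ p → ∣ p ∣ ≡ suc ∣ p - x ∣
∣p∣≡1+∣p-x∣ {p = inside  ∷ p} here        = cong (suc ∘ ∣_∣) (sym (p─⊥≡p p))
∣p∣≡1+∣p-x∣ {p = inside  ∷ p} (there x∈p) = cong suc (∣p∣≡1+∣p-x∣ x∈p)
∣p∣≡1+∣p-x∣ {p = outside ∷ p} (there x∈p) = ∣p∣≡1+∣p-x∣ x∈p

∣p∪⁅x⁆∣≡1+∣p∣ : ∀ {n} {p : Subset n} {x} → x ∉ p → ∣ p ∪ ⁅ x ⁆ ∣ ≡ suc ∣ p ∣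
∣p∪⁅x⁆∣≡1+∣p∣ {p = inside  ∷ p} {zero}  x∉p = ⊥-elim (x∉p here)
∣p∪⁅x⁆∣≡1+∣p∣ {p = outside ∷ p} {zero}  x∉p = cong (suc ∘ ∣_∣) (∪-identityʳ p)
∣p∪⁅x⁆∣≡1+∣p∣ {p = inside  ∷ p} {suc x} x∉p = cong suc (∣p∪⁅x⁆∣≡1+∣p∣ (x∉p ∘ there))
∣p∪⁅x⁆∣≡1+∣p∣ {p = outside ∷ p} {suc x} x∉p = ∣p∪⁅x⁆∣≡1+∣p∣ (x∉p ∘ there)

data ↑-View {n m : ℕ} : Fin (n ℕ.+ m) → Set where
  left  : ∀ x → ↑-View (x ↑ˡ m)
  right : ∀ j → ↑-View (n ↑ʳ j)

↑-view : ∀ n {m} (i : Fin (n ℕ.+ m)) → ↑-View {n} {m} i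
↑-view zero    i       = right i
↑-view (suc n) zero    = left zero
↑-view (suc n) (suc i) with ↑-view n i
... | left x  = left (suc x)
... | right j = right j

∈-++⁺ˡ : ∀ {n m} {X : Subset n} {Z : Subset m} {x} → x ∈ X → x ↑ˡ m ∈ X Vec.++ Z
∈-++⁺ˡ here        = here
∈-++⁺ˡ (there x∈X) = there (∈-++⁺ˡ x∈X)

∈-++⁻ˡ : ∀ {n m} (X : Subset n) {Z : Subset m} {x} → x ↑ˡ m ∈ X Vec.++ Z → x ∈ X
∈-++⁻ˡ (_ ∷ X) {x = zero}  here       = here
∈-++⁻ˡ (_ ∷ X) {x = suc x} (there x∈) = there (∈-++⁻ˡ X x∈)

∈-++⁻ʳ : ∀ {n m} (X : Subset n) {Z : Subset m} {j} → n ↑ʳ j ∈ X Vec.++ Z → j ∈ Z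
∈-++⁻ʳ []      j∈         = j∈
∈-++⁻ʳ (_ ∷ X) (there j∈) = ∈-++⁻ʳ X j∈

++-mono-⊆ : ∀ {n m} {Y X : Subset n} {Y′ Z : Subset m} →
            Y ⊆ X → Y′ ⊆ Z → Y Vec.++ Y′ ⊆ X Vec.++ Z
++-mono-⊆ {Y = []}    {[]}    Y⊆X Y′⊆Z i∈ = Y′⊆Z i∈
++-mono-⊆ {Y = _ ∷ _} {_ ∷ _} Y⊆X Y′⊆Z here with Y⊆X here
... | here = here
++-mono-⊆ {Y = _ ∷ _} {_ ∷ _} Y⊆X Y′⊆Z (there i∈) = there (++-mono-⊆ (drop-∷-⊆ Y⊆X) Y′⊆Z i∈)

∣p++⊥∣≡∣p∣ : ∀ {n m} (p : Subset n) → ∣ p Vec.++ ⊥ {m} ∣ ≡ ∣ p ∣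
∣p++⊥∣≡∣p∣ {m = m} []    = ∣⊥∣≡0 m
∣p++⊥∣≡∣p∣ (inside  ∷ p) = cong suc (∣p++⊥∣≡∣p∣ p)
∣p++⊥∣≡∣p∣ (outside ∷ p) = ∣p++⊥∣≡∣p∣ p

⊤≡⊤++⊤ : ∀ {n m} → ⊤ {n ℕ.+ m} ≡ ⊤ {n} Vec.++ ⊤ {m}
⊤≡⊤++⊤ {zero}  = refl
⊤≡⊤++⊤ {suc n} = cong (inside ∷_) (⊤≡⊤++⊤ {n})

tabulate-++ : ∀ {A : Set} {n m} (f : Fin (n ℕ.+ m) → A) →
              tabulate f ≡ tabulate (f ∘ (_↑ˡ m)) Vec.++ tabulate (f ∘ (n ↑ʳ_))
tabulate-++ {n = zero}      f = refl
tabulate-++ {n = suc n} {m} f = cong (f zero ∷_) (tabulate-++ {n = n} {m} (f ∘ suc))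

∈-tabulate⁻ : ∀ {n} {f : Fin n → Bool} {x} → x ∈ tabulate f → f x ≡ true
∈-tabulate⁻ {f = f} {x} x∈ = trans (sym (lookup∘tabulate f x)) ([]=⇒lookup x∈)

∈-map-not-tabulate⁻ : ∀ {n} {f : Fin n → Bool} {x} → x ∈ Vec.map not (tabulate f) → f x ≡ false
∈-map-not-tabulate⁻ {f = f} {x} x∈ = not-injective (begin
  not (f x)                             ≡⟨ cong not (lookup∘tabulate f x) ⟨
  not (lookup (tabulate f) x)           ≡⟨ lookup-map x not (tabulate f) ⟨
  lookup (Vec.map not (tabulate f)) x   ≡⟨ []=⇒lookup x∈ ⟩
  true                                  ∎)
  where open ≡-Reasoning

∈-map-not-tabulate⁺ : ∀ {n} {f : Fin n → Bool} {x} → f x ≢ true → x ∈ Vec.map not (tabulate f)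
∈-map-not-tabulate⁺ {f = f} {x} fx≢true = lookup⇒[]= x _ (begin
  lookup (Vec.map not (tabulate f)) x   ≡⟨ lookup-map x not (tabulate f) ⟩
  not (lookup (tabulate f) x)           ≡⟨ cong not (lookup∘tabulate f x) ⟩
  not (f x)                             ≡⟨ cong not (¬-not fx≢true) ⟩
  true                                  ∎)
  where open ≡-Reasoning

foldr-+-mono-≤ : ∀ {A : Set} {P : A → Set} {f g : A → ℕ} {xs} → All P xs → (∀ {x} → P x → f x ≤ g x) →
                 List.foldr ℕ._+_ 0 (List.map f xs) ≤ List.foldr ℕ._+_ 0 (List.map g xs)
foldr-+-mono-≤ []            f≤g = z≤n
foldr-+-mono-≤ (px All.∷ ps) f≤g = ℕ.+-mono-≤ (f≤g px) (foldr-+-mono-≤ ps f≤g)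

module LinearAlgebra {q : ℕ} (𝔽 : FiniteField q) where
  open FiniteField 𝔽
  open GF 𝔽

  private
    commutativeRing : CommutativeRing _ _
    commutativeRing = record { isCommutativeRing = isCommutativeRing }

  open CommutativeRing commutativeRing
    using ( +-assoc; +-comm; +-identityˡ; +-identityʳ; -‿inverseʳ; *-assoc; *-comm; *-identityˡ
          ; *-identityʳ; distribˡ; distribʳ; zeroˡ; zeroʳ; ring; +-commutativeSemigroup )
  open CommutativeSemigroupProperties +-commutativeSemigroup using (interchange)
  open RingProperties ring using (-1*x≈-x; -‿distribˡ-*)

  lookup-extensionality : ∀ {r} {x y : Vec F r} → (∀ i → lookup x i ≡ lookup y i) → x ≡ y
  lookup-extensionality x≗y = Extensional.Pointwise-≡⇒≡ (Extensional.ext x≗y)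

  lookup-⊕ : ∀ {r} (x y : Vec F r) i → lookup (x ⊕ y) i ≡ lookup x i + lookup y i
  lookup-⊕ x y i = lookup-zipWith _+_ i x y

  lookup-· : ∀ {r} a (x : Vec F r) i → lookup (a · x) i ≡ a * lookup x i
  lookup-· a x i = lookup-map i (a *_) x

  lookup-0v : ∀ {r} (i : Fin r) → lookup 0v i ≡ 0#
  lookup-0v i = lookup-replicate i 0#

  ⊕-assoc : ∀ {r} (x y z : Vec F r) → (x ⊕ y) ⊕ z ≡ x ⊕ (y ⊕ z)
  ⊕-assoc x y z = Pointwise-≡⇒≡ (zipWith-assoc +-assoc x y z)

  ⊕-comm : ∀ {r} (x y : Vec F r) → x ⊕ y ≡ y ⊕ x
  ⊕-comm x y = Pointwise-≡⇒≡ (zipWith-comm +-comm x y)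

  ⊕-identityˡ : ∀ {r} (x : Vec F r) → 0v ⊕ x ≡ x
  ⊕-identityˡ x = Pointwise-≡⇒≡ (zipWith-identityˡ +-identityˡ x)

  ⊕-identityʳ : ∀ {r} (x : Vec F r) → x ⊕ 0v ≡ x
  ⊕-identityʳ x = trans (⊕-comm x 0v) (⊕-identityˡ x)

  ⊕-interchange : ∀ {r} (w x y z : Vec F r) → (w ⊕ x) ⊕ (y ⊕ z) ≡ (w ⊕ y) ⊕ (x ⊕ z)
  ⊕-interchange []      []      []      []      = refl
  ⊕-interchange (a ∷ w) (b ∷ x) (c ∷ y) (d ∷ z) =
    cong₂ _∷_ (interchange a b c d) (⊕-interchange w x y z)

  ·-distribˡ : ∀ {r} a (x y : Vec F r) → a · (x ⊕ y) ≡ (a · x) ⊕ (a · y)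
  ·-distribˡ a []      []      = refl
  ·-distribˡ a (b ∷ x) (c ∷ y) = cong₂ _∷_ (distribˡ a b c) (·-distribˡ a x y)

  ·-distribʳ : ∀ {r} a b (x : Vec F r) → (a + b) · x ≡ (a · x) ⊕ (b · x)
  ·-distribʳ a b []      = refl
  ·-distribʳ a b (c ∷ x) = cong₂ _∷_ (distribʳ c a b) (·-distribʳ a b x)

  ·-assoc : ∀ {r} a b (x : Vec F r) → (a * b) · x ≡ a · (b · x)
  ·-assoc a b []      = refl
  ·-assoc a b (c ∷ x) = cong₂ _∷_ (*-assoc a b c) (·-assoc a b x)

  ·-identityˡ : ∀ {r} (x : Vec F r) → 1# · x ≡ x
  ·-identityˡ []      = refl
  ·-identityˡ (c ∷ x) = cong₂ _∷_ (*-identityˡ c) (·-identityˡ x)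

  ·-zeroˡ : ∀ {r} (x : Vec F r) → 0# · x ≡ 0v
  ·-zeroˡ []      = refl
  ·-zeroˡ (c ∷ x) = cong₂ _∷_ (zeroˡ c) (·-zeroˡ x)

  ·-zeroʳ : ∀ {r} a → a · 0v {r} ≡ 0v
  ·-zeroʳ {zero}  a = refl
  ·-zeroʳ {suc r} a = cong₂ _∷_ (zeroʳ a) (·-zeroʳ a)

  ⊕-inverseʳ : ∀ {r} (x : Vec F r) → x ⊕ ((- 1#) · x) ≡ 0v
  ⊕-inverseʳ []      = refl
  ⊕-inverseʳ (c ∷ x) = cong₂ _∷_ (trans (cong (c +_) (-1*x≈-x c)) (-‿inverseʳ c)) (⊕-inverseʳ x)

  ⊕≡0v⇒≡-1· : ∀ {r} (x y : Vec F r) → x ⊕ y ≡ 0v → x ≡ (- 1#) · y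
  ⊕≡0v⇒≡-1· x y x⊕y≡0 = begin
    x                          ≡⟨ ⊕-identityʳ x ⟨
    x ⊕ 0v                     ≡⟨ cong (x ⊕_) (⊕-inverseʳ y) ⟨
    x ⊕ (y ⊕ ((- 1#) · y))     ≡⟨ ⊕-assoc x y _ ⟨
    (x ⊕ y) ⊕ ((- 1#) · y)     ≡⟨ cong (_⊕ ((- 1#) · y)) x⊕y≡0 ⟩
    0v ⊕ ((- 1#) · y)          ≡⟨ ⊕-identityˡ _ ⟩
    (- 1#) · y                 ∎
    where open ≡-Reasoning

  unitVec : ∀ {n} → Fin n → Vec F n
  unitVec zero    = 1# ∷ 0v
  unitVec (suc x) = 0# ∷ unitVec x

  lookup-unitVec-≡ : ∀ {n} (x : Fin n) → lookup (unitVec x) x ≡ 1#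
  lookup-unitVec-≡ zero    = refl
  lookup-unitVec-≡ (suc x) = lookup-unitVec-≡ x

  lookup-unitVec-≢ : ∀ {n} (x : Fin n) {y} → y ≢ x → lookup (unitVec x) y ≡ 0#
  lookup-unitVec-≢ zero    {zero}  y≢x = ⊥-elim (y≢x refl)
  lookup-unitVec-≢ zero    {suc y} y≢x = lookup-0v y
  lookup-unitVec-≢ (suc x) {zero}  y≢x = refl
  lookup-unitVec-≢ (suc x) {suc y} y≢x = lookup-unitVec-≢ x (y≢x ∘ cong suc)

  lookup-⊕-·unitVec : ∀ {n} (c : Vec F n) a {x i} → i ≢ x → lookup (c ⊕ (a · unitVec x)) i ≡ lookup c i
  lookup-⊕-·unitVec c a {x} {i} i≢x = begin
    lookup (c ⊕ (a · unitVec x)) i         ≡⟨ lookup-⊕ c _ i ⟩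
    lookup c i + lookup (a · unitVec x) i  ≡⟨ cong (lookup c i +_) (lookup-· a (unitVec x) i) ⟩
    lookup c i + a * lookup (unitVec x) i  ≡⟨ cong (λ y → lookup c i + a * y) (lookup-unitVec-≢ x i≢x) ⟩
    lookup c i + a * 0#                    ≡⟨ cong (lookup c i +_) (zeroʳ a) ⟩
    lookup c i + 0#                        ≡⟨ +-identityʳ _ ⟩
    lookup c i                             ∎
    where open ≡-Reasoning

  lincomb-⊕-coeffs : ∀ {r n} (c d : Vec F n) (v : Fin n → Vec F r) →
                     lincomb (c ⊕ d) v ≡ lincomb c v ⊕ lincomb d v
  lincomb-⊕-coeffs []      []      v = sym (⊕-identityˡ 0v)
  lincomb-⊕-coeffs (a ∷ c) (b ∷ d) v =
    trans (cong₂ _⊕_ (·-distribʳ a b (v zero)) (lincomb-⊕-coeffs c d (v ∘ suc))) (⊕-interchange _ _ _ _)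

  lincomb-·-coeffs : ∀ {r n} a (c : Vec F n) (v : Fin n → Vec F r) → lincomb (a · c) v ≡ a · lincomb c v
  lincomb-·-coeffs a []      v = sym (·-zeroʳ a)
  lincomb-·-coeffs a (b ∷ c) v =
    trans (cong₂ _⊕_ (·-assoc a b (v zero)) (lincomb-·-coeffs a c (v ∘ suc))) (sym (·-distribˡ a _ _))

  lincomb-0v-coeffs : ∀ {r n} (v : Fin n → Vec F r) → lincomb 0v v ≡ 0v
  lincomb-0v-coeffs {n = zero}  v = refl
  lincomb-0v-coeffs {n = suc n} v =
    trans (cong₂ _⊕_ (·-zeroˡ (v zero)) (lincomb-0v-coeffs (v ∘ suc))) (⊕-identityˡ 0v)

  lincomb-⊕-family : ∀ {r n} (c : Vec F n) (v w : Fin n → Vec F r) →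
                     lincomb c (λ j → v j ⊕ w j) ≡ lincomb c v ⊕ lincomb c w
  lincomb-⊕-family []      v w = sym (⊕-identityˡ 0v)
  lincomb-⊕-family (a ∷ c) v w =
    trans (cong₂ _⊕_ (·-distribˡ a (v zero) (w zero)) (lincomb-⊕-family c (v ∘ suc) (w ∘ suc)))
          (⊕-interchange _ _ _ _)

  dot : ∀ {n} → Vec F n → (Fin n → F) → F
  dot []      l = 0#
  dot (a ∷ c) l = a * l zero + dot c (l ∘ suc)

  lincomb-multiples : ∀ {r n} (c : Vec F n) (l : Fin n → F) (w : Vec F r) →
                      lincomb c (λ j → l j · w) ≡ dot c l · w
  lincomb-multiples []      l w = sym (·-zeroˡ w)
  lincomb-multiples (a ∷ c) l w =
    trans (cong₂ _⊕_ (sym (·-assoc a (l zero) w)) (lincomb-multiples c (l ∘ suc) w))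
          (sym (·-distribʳ _ _ w))

  lincomb-cong : ∀ {r n} (c : Vec F n) {v w : Fin n → Vec F r} → (∀ i → v i ≡ w i) →
                 lincomb c v ≡ lincomb c w
  lincomb-cong []      v≗w = refl
  lincomb-cong (a ∷ c) v≗w = cong₂ _⊕_ (cong (a ·_) (v≗w zero)) (lincomb-cong c (v≗w ∘ suc))

  lincomb-lincomb : ∀ {r n N} (c : Vec F n) (b : Fin n → Vec F N) (v : Fin N → Vec F r) →
                    lincomb c (λ x → lincomb (b x) v) ≡ lincomb (lincomb c b) v
  lincomb-lincomb []      b v = sym (lincomb-0v-coeffs v)
  lincomb-lincomb (a ∷ c) b v =
    trans (cong₂ _⊕_ (sym (lincomb-·-coeffs a (b zero) v)) (lincomb-lincomb c (b ∘ suc) v))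
          (sym (lincomb-⊕-coeffs (a · b zero) (lincomb c (b ∘ suc)) v))

  lincomb-unitVec : ∀ {r n} (x : Fin n) (v : Fin n → Vec F r) → lincomb (unitVec x) v ≡ v x
  lincomb-unitVec zero    v =
    trans (cong₂ _⊕_ (·-identityˡ (v zero)) (lincomb-0v-coeffs (v ∘ suc))) (⊕-identityʳ _)
  lincomb-unitVec (suc x) v =
    trans (cong₂ _⊕_ (·-zeroˡ (v zero)) (lincomb-unitVec x (v ∘ suc))) (⊕-identityˡ _)

  lookup-lincomb≡0 : ∀ {r n} (c : Vec F n) (w : Fin n → Vec F r) i →
                     (∀ x → lookup (w x) i ≡ 0#) → lookup (lincomb c w) i ≡ 0#
  lookup-lincomb≡0 []      w i w≡0 = lookup-0v i
  lookup-lincomb≡0 (a ∷ c) w i w≡0 = begin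
    lookup ((a · w zero) ⊕ lincomb c (w ∘ suc)) i           ≡⟨ lookup-⊕ (a · w zero) _ i ⟩
    lookup (a · w zero) i + lookup (lincomb c (w ∘ suc)) i  ≡⟨ cong₂ _+_ (lookup-· a (w zero) i)
                                                                 (lookup-lincomb≡0 c (w ∘ suc) i (w≡0 ∘ suc)) ⟩
    a * lookup (w zero) i + 0#                              ≡⟨ cong (λ y → a * y + 0#) (w≡0 zero) ⟩
    a * 0# + 0#                                             ≡⟨ trans (+-identityʳ _) (zeroʳ a) ⟩
    0#                                                      ∎
    where open ≡-Reasoning

  lincomb-++ : ∀ {r n m} (c₁ : Vec F n) (c₂ : Vec F m) (e : Fin n → Vec F r) (s : Fin m → Vec F r) →
               lincomb (c₁ Vec.++ c₂) (e ++ s) ≡ lincomb c₁ e ⊕ lincomb c₂ s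
  lincomb-++ []       c₂ e s = sym (⊕-identityˡ _)
  lincomb-++ {n = suc n} (a ∷ c₁) c₂ e s =
    trans (cong ((a · e zero) ⊕_) (trans (lincomb-cong (c₁ Vec.++ c₂) (λ i → [,]-map (splitAt n i)))
                                         (lincomb-++ c₁ c₂ (e ∘ suc) s)))
          (sym (⊕-assoc _ _ _))

  SupportedIn : ∀ {n} → Vec F n → Subset n → Set
  SupportedIn c Y = ∀ i → i ∉ Y → lookup c i ≡ 0#

  InSpan : ∀ {r n} → (Fin n → Vec F r) → Subset n → Vec F r → Set
  InSpan v Y p = ∃[ c ] (SupportedIn c Y × lincomb c v ≡ p)

  SupportedIn-· : ∀ {n} a (c : Vec F n) {Y} → SupportedIn c Y → SupportedIn (a · c) Y
  SupportedIn-· a c supp i i∉Y = trans (lookup-· a c i) (trans (cong (a *_) (supp i i∉Y)) (zeroʳ a))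

  SupportedIn-tail : ∀ {n a s} {c : Vec F n} {Y} → SupportedIn (a ∷ c) (s ∷ Y) → SupportedIn c Y
  SupportedIn-tail supp i i∉Y = supp (suc i) (λ { (there i∈Y) → i∉Y i∈Y })

  unitVec-supported : ∀ {n} {x : Fin n} {Y} → x ∈ Y → SupportedIn (unitVec x) Y
  unitVec-supported {x = x} x∈Y i i∉Y = lookup-unitVec-≢ x (λ { refl → i∉Y x∈Y })

  InSpan-mono : ∀ {r n} {v : Fin n → Vec F r} {Y Z p} → Y ⊆ Z → InSpan v Y p → InSpan v Z p
  InSpan-mono Y⊆Z (c , supp , c≡p) = c , (λ i i∉Z → supp i (i∉Z ∘ Y⊆Z)) , c≡p

  lincomb-cong-on : ∀ {r n} (c : Vec F n) {Q} {v w : Fin n → Vec F r} → SupportedIn c Q →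
                    (∀ x → x ∈ Q → v x ≡ w x) → lincomb c v ≡ lincomb c w
  lincomb-cong-on []      {[]}          supp v≗w = refl
  lincomb-cong-on (a ∷ c) {inside ∷ Q}  supp v≗w =
    cong₂ _⊕_ (cong (a ·_) (v≗w zero here))
              (lincomb-cong-on c (SupportedIn-tail supp) (λ x → v≗w (suc x) ∘ there))
  lincomb-cong-on (a ∷ c) {outside ∷ Q} {v} {w} supp v≗w =
    cong₂ _⊕_ (trans (vanishes v) (sym (vanishes w)))
              (lincomb-cong-on c (SupportedIn-tail supp) (λ x → v≗w (suc x) ∘ there))
    where
    vanishes : ∀ u → a · u zero ≡ 0v
    vanishes u = trans (cong (_· u zero) (supp zero λ ())) (·-zeroˡ (u zero))

  coefficients : ∀ {r n N} {v : Fin n → Vec F r} {I : Subset n} {Q : Subset N} {w : Fin N → Vec F r} →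
                 (∀ x → x ∈ Q → InSpan v I (w x)) →
                 ∃[ a ] (∀ x → SupportedIn (a x) I × (x ∈ Q → lincomb (a x) v ≡ w x))
  coefficients {Q = Q} spanned = (λ x → proj₁ (choose x)) , (λ x → proj₂ (choose x))
    where
    choose : ∀ x → ∃[ a ] (SupportedIn a _ × (x ∈ Q → lincomb a _ ≡ _))
    choose x with x ∈? Q
    ... | yes x∈Q = let (a , supp , a≡wx) = spanned x x∈Q in a , supp , λ _ → a≡wx
    ... | no x∉Q  = 0v , (λ i _ → lookup-0v i) , ⊥-elim ∘ x∉Q

  InSpan-trans : ∀ {r n} {v : Fin n → Vec F r} {Q I p} →
                 (∀ x → x ∈ Q → InSpan v I (v x)) → InSpan v Q p → InSpan v I p
  InSpan-trans {v = v} {Q} {I} {p} spanned (c , supp , c≡p) with coefficients spanned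
  ... | b , b-spans = lincomb c b , supported , (begin
    lincomb (lincomb c b) v            ≡⟨ lincomb-lincomb c b v ⟨
    lincomb c (λ x → lincomb (b x) v)  ≡⟨ lincomb-cong-on c supp (λ x → proj₂ (b-spans x)) ⟩
    lincomb c v                        ≡⟨ c≡p ⟩
    p                                  ∎)
    where
    open ≡-Reasoning
    supported : SupportedIn (lincomb c b) I
    supported i i∉I = lookup-lincomb≡0 c b i (λ x → proj₁ (b-spans x) i i∉I)

  ∃F? : {P : F → Set} → (∀ x → Dec (P x)) → Dec (∃[ x ] P x)
  ∃F? {P} P? = map′ (λ (i , p) → _ , p)
                    (λ (x , px) → Inverse.from enumeration x ,
                                  subst P (sym (Inverse.inverseˡ enumeration refl)) px)
                    (any? (P? ∘ Inverse.to enumeration))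

  ∃Vec? : ∀ n {P : Vec F n → Set} → (∀ c → Dec (P c)) → Dec (∃[ c ] P c)
  ∃Vec? zero    P? = map′ ([] ,_) (λ { ([] , p) → p }) (P? [])
  ∃Vec? (suc n) P? = map′ (λ (x , c , p) → x ∷ c , p) (λ { (x ∷ c , p) → x , c , p })
                          (∃F? (λ x → ∃Vec? n (P? ∘ (x ∷_))))

  inSpan? : ∀ {r n} (v : Fin n → Vec F r) Y p → Dec (InSpan v Y p)
  inSpan? {n = n} v Y p = ∃Vec? n (λ c → all? (λ i → ¬? (i ∈? Y) →-dec (lookup c i ≟F 0#))
                                         ×-dec ≡-dec _≟F_ (lincomb c v) p)

  Indep⇒≢0v : ∀ {r n} {v : Fin n → Vec F r} {J j} → Indep v J → j ∈ J → v j ≢ 0v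
  Indep⇒≢0v {v = v} {j = j} ind j∈J vj≡0 =
    0≢1 (trans (sym (ind (unitVec j) (unitVec-supported j∈J) (trans (lincomb-unitVec j v) vj≡0) j))
               (lookup-unitVec-≡ j))

  -- With a ≠ 0, the relation would put p = Σ (- a⁻¹ c) v in the span.
  Indep-adjoin : ∀ {r n} {v : Fin n → Vec F r} {I p} → Indep v I → ¬ InSpan v I p →
                 ∀ a c → SupportedIn c I → (a · p) ⊕ lincomb c v ≡ 0v →
                 a ≡ 0# × (∀ i → lookup c i ≡ 0#)
  Indep-adjoin {v = v} {I} {p} ind p∉span a c supp eq with a ≟F 0#
  ... | yes a≡0 = a≡0 , ind c supp (begin
    lincomb c v              ≡⟨ ⊕-identityˡ _ ⟨
    0v ⊕ lincomb c v         ≡⟨ cong (_⊕ lincomb c v) (trans (cong (_· p) a≡0) (·-zeroˡ p)) ⟨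
    (a · p) ⊕ lincomb c v    ≡⟨ eq ⟩
    0v                       ∎)
    where open ≡-Reasoning
  ... | no a≢0 with inverse a a≢0
  ...   | a⁻¹ , aa⁻¹≡1 = ⊥-elim (p∉span ((a⁻¹ * - 1#) · c , SupportedIn-· _ c supp , p-spanned))
    where
    open ≡-Reasoning
    p-spanned : lincomb ((a⁻¹ * - 1#) · c) v ≡ p
    p-spanned = begin
      lincomb ((a⁻¹ * - 1#) · c) v    ≡⟨ lincomb-·-coeffs _ c v ⟩
      (a⁻¹ * - 1#) · lincomb c v      ≡⟨ ·-assoc a⁻¹ (- 1#) _ ⟩
      a⁻¹ · ((- 1#) · lincomb c v)    ≡⟨ cong (a⁻¹ ·_) (⊕≡0v⇒≡-1· (a · p) _ eq) ⟨
      a⁻¹ · (a · p)                   ≡⟨ ·-assoc a⁻¹ a p ⟨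
      (a⁻¹ * a) · p                   ≡⟨ cong (_· p) (trans (*-comm a⁻¹ a) aa⁻¹≡1) ⟩
      1# · p                          ≡⟨ ·-identityˡ p ⟩
      p                               ∎

  Indep-∷ : ∀ {r n} {v : Fin n → Vec F r} {I p} → Indep v I → ¬ InSpan v I p →
            Indep (p VF.∷ v) (inside ∷ I)
  Indep-∷ ind p∉span (a ∷ c) supp eq zero    =
    proj₁ (Indep-adjoin ind p∉span a c (SupportedIn-tail supp) eq)
  Indep-∷ ind p∉span (a ∷ c) supp eq (suc i) =
    proj₂ (Indep-adjoin ind p∉span a c (SupportedIn-tail supp) eq) i

  Indep-∪⁅⁆ : ∀ {r n} {v : Fin n → Vec F r} {I x} → Indep v I → ¬ InSpan v I (v x) →
              Indep v (I ∪ ⁅ x ⁆)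
  Indep-∪⁅⁆ {v = v} {I} {x} ind vx∉span c supp eq = c≡0
    where
    open ≡-Reasoning
    c′ : Vec F _
    c′ = c [ x ]≔ 0#
    cx : F
    cx = lookup c x

    c′-agrees : ∀ i → i ≢ x → lookup c′ i ≡ lookup c i
    c′-agrees i i≢x = lookup∘updateAt′ i x i≢x c

    c′-supported : SupportedIn c′ I
    c′-supported i i∉I with i ≟ᶠ x
    ... | yes refl = lookup∘updateAt x c
    ... | no i≢x   = trans (c′-agrees i i≢x)
                           (supp i (λ i∈ → [ i∉I , i≢x ∘ x∈⁅y⁆⇒x≡y x ]′ (x∈p∪q⁻ I ⁅ x ⁆ i∈)))

    c-split : c ≡ c′ ⊕ (cx · unitVec x)
    c-split = lookup-extensionality λ i → sym (coordinate i)
      where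
      coordinate : ∀ i → lookup (c′ ⊕ (cx · unitVec x)) i ≡ lookup c i
      coordinate i with i ≟ᶠ x
      ... | no i≢x   = trans (lookup-⊕-·unitVec c′ cx i≢x) (c′-agrees i i≢x)
      ... | yes refl = begin
        lookup (c′ ⊕ (cx · unitVec x)) x         ≡⟨ lookup-⊕ c′ _ x ⟩
        lookup c′ x + lookup (cx · unitVec x) x  ≡⟨ cong₂ _+_ (lookup∘updateAt x c) (lookup-· cx (unitVec x) x) ⟩
        0# + cx * lookup (unitVec x) x           ≡⟨ +-identityˡ _ ⟩
        cx * lookup (unitVec x) x                ≡⟨ cong (cx *_) (lookup-unitVec-≡ x) ⟩
        cx * 1#                                  ≡⟨ *-identityʳ cx ⟩
        cx                                       ∎

    relation : (cx · v x) ⊕ lincomb c′ v ≡ 0v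
    relation = begin
      (cx · v x) ⊕ lincomb c′ v                    ≡⟨ ⊕-comm _ _ ⟩
      lincomb c′ v ⊕ (cx · v x)                    ≡⟨ cong (λ w → lincomb c′ v ⊕ (cx · w)) (lincomb-unitVec x v) ⟨
      lincomb c′ v ⊕ (cx · lincomb (unitVec x) v)  ≡⟨ cong (lincomb c′ v ⊕_) (lincomb-·-coeffs cx (unitVec x) v) ⟨
      lincomb c′ v ⊕ lincomb (cx · unitVec x) v    ≡⟨ lincomb-⊕-coeffs c′ _ v ⟨
      lincomb (c′ ⊕ (cx · unitVec x)) v            ≡⟨ cong (λ d → lincomb d v) c-split ⟨
      lincomb c v                                  ≡⟨ eq ⟩
      0v                                           ∎

    c≡0 : ∀ i → lookup c i ≡ 0#
    c≡0 i with i ≟ᶠ x | Indep-adjoin ind vx∉span cx c′ c′-supported relation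
    ... | yes refl | cx≡0 , _ = cx≡0
    ... | no i≢x   | _ , c′≡0 = trans (sym (c′-agrees i i≢x)) (c′≡0 i)

  Indep-shear : ∀ {r n} {v : Fin n → Vec F r} {J t} (l : Fin n → F) → t ∈ J → Indep v J →
                Indep (λ j → v j ⊕ (l j · v t)) (J - t)
  Indep-shear {v = v} {J} {t} l t∈J ind c supp eq = c≡0
    where
    open ≡-Reasoning
    c₊ : Vec F _
    c₊ = c ⊕ (dot c l · unitVec t)

    c₊-supported : SupportedIn c₊ J
    c₊-supported i i∉J =
      trans (lookup-⊕-·unitVec c _ (λ { refl → i∉J t∈J })) (supp i (i∉J ∘ p─q⊆p J ⁅ t ⁆))

    c₊-relation : lincomb c₊ v ≡ 0v
    c₊-relation = begin
      lincomb c₊ v                                     ≡⟨ lincomb-⊕-coeffs c _ v ⟩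
      lincomb c v ⊕ lincomb (dot c l · unitVec t) v    ≡⟨ cong (lincomb c v ⊕_) (lincomb-·-coeffs _ (unitVec t) v) ⟩
      lincomb c v ⊕ (dot c l · lincomb (unitVec t) v)  ≡⟨ cong (λ w → lincomb c v ⊕ (dot c l · w)) (lincomb-unitVec t v) ⟩
      lincomb c v ⊕ (dot c l · v t)                    ≡⟨ cong (lincomb c v ⊕_) (lincomb-multiples c l (v t)) ⟨
      lincomb c v ⊕ lincomb c (λ j → l j · v t)        ≡⟨ lincomb-⊕-family c v _ ⟨
      lincomb c (λ j → v j ⊕ (l j · v t))              ≡⟨ eq ⟩
      0v                                               ∎

    c≡0 : ∀ i → lookup c i ≡ 0#
    c≡0 i with i ≟ᶠ t
    ... | yes refl = supp t (x∉p-x J t)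
    ... | no i≢t   = trans (sym (lookup-⊕-·unitVec c _ i≢t)) (ind c₊ c₊-supported c₊-relation i)

  record Expresses {r N N'} (a : Fin N' → Vec F N) (u : Fin N → Vec F r) (I : Subset N)
                   (v : Fin N' → Vec F r) (J : Subset N') : Set where
    constructor expresses
    field rows : ∀ j → j ∈ J → SupportedIn (a j) I × lincomb (a j) u ≡ v j
  open Expresses

  Expresses-over-∅ : ∀ {r N N'} {a : Fin N' → Vec F N} {u : Fin N → Vec F r} {I v J} →
                     Indep v J → Expresses a u I v J → (∀ i → i ∉ I) → ∣ J ∣ ≡ 0
  Expresses-over-∅ {N' = N'} {a} {u} {J = J} ind exp I-empty with nonempty? J
  ... | no J-empty    = trans (cong ∣_∣ (Empty-unique J-empty)) (∣⊥∣≡0 N')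
  ... | yes (j , j∈J) = ⊥-elim (Indep⇒≢0v ind j∈J vj≡0)
    where
    aj≡0 : a j ≡ 0v
    aj≡0 = lookup-extensionality λ i → trans (proj₁ (rows exp j j∈J) i (I-empty i)) (sym (lookup-0v i))
    vj≡0 = trans (sym (proj₂ (rows exp j j∈J))) (trans (cong (λ c → lincomb c u) aj≡0) (lincomb-0v-coeffs u))

  Expresses-drop : ∀ {r N N'} {a : Fin N' → Vec F N} {u : Fin N → Vec F r} {I v J i} →
                   Expresses a u I v J → (∀ j → j ∈ J → lookup (a j) i ≡ 0#) → Expresses a u (I - i) v J
  Expresses-drop {a = a} {I = I} {J = J} {i} exp aᵢ≡0 =
    expresses λ j j∈J → supported j j∈J , proj₂ (rows exp j j∈J)
    where
    supported : ∀ j → j ∈ J → SupportedIn (a j) (I - i)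
    supported j j∈J i′ i′∉I-i with i′ ≟ᶠ i
    ... | yes refl = aᵢ≡0 j j∈J
    ... | no i′≢i  = proj₁ (rows exp j j∈J) i′ (λ i′∈I → i′∉I-i (x∈p∧x≢y⇒x∈p-y i′∈I i′≢i))

  Expresses-eliminate : ∀ {r N N'} {a : Fin N' → Vec F N} {u : Fin N → Vec F r} {I v J i t} →
                        Expresses a u I v J → t ∈ J → (l : Fin N' → F) →
                        (∀ j → lookup (a j) i + l j * lookup (a t) i ≡ 0#) →
                        Expresses (λ j → a j ⊕ (l j · a t)) u (I - i) (λ j → v j ⊕ (l j · v t)) (J - t)
  Expresses-eliminate {a = a} {u} {I} {v} {J} {i} {t} exp t∈J l cancels =
    expresses λ j j∈J-t → supported j (p─q⊆p J ⁅ t ⁆ j∈J-t) , expressed j (p─q⊆p J ⁅ t ⁆ j∈J-t)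
    where
    open ≡-Reasoning
    supported : ∀ j → j ∈ J → SupportedIn (a j ⊕ (l j · a t)) (I - i)
    supported j j∈J i′ i′∉I-i with i′ ≟ᶠ i
    ... | yes refl = begin
      lookup (a j ⊕ (l j · a t)) i            ≡⟨ lookup-⊕ (a j) _ i ⟩
      lookup (a j) i + lookup (l j · a t) i   ≡⟨ cong (lookup (a j) i +_) (lookup-· (l j) (a t) i) ⟩
      lookup (a j) i + l j * lookup (a t) i   ≡⟨ cancels j ⟩
      0#                                      ∎
    ... | no i′≢i  = begin
      lookup (a j ⊕ (l j · a t)) i′            ≡⟨ lookup-⊕ (a j) _ i′ ⟩
      lookup (a j) i′ + lookup (l j · a t) i′  ≡⟨ cong₂ _+_ (proj₁ (rows exp j j∈J) i′ i′∉I)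
                                                            (SupportedIn-· (l j) (a t) at-supported i′ i′∉I) ⟩
      0# + 0#                                  ≡⟨ +-identityʳ 0# ⟩
      0#                                       ∎
      where
      i′∉I : i′ ∉ I
      i′∉I i′∈I = i′∉I-i (x∈p∧x≢y⇒x∈p-y i′∈I i′≢i)
      at-supported = proj₁ (rows exp t t∈J)
    expressed : ∀ j → j ∈ J → lincomb (a j ⊕ (l j · a t)) u ≡ v j ⊕ (l j · v t)
    expressed j j∈J = begin
      lincomb (a j ⊕ (l j · a t)) u              ≡⟨ lincomb-⊕-coeffs (a j) _ u ⟩
      lincomb (a j) u ⊕ lincomb (l j · a t) u    ≡⟨ cong (lincomb (a j) u ⊕_) (lincomb-·-coeffs (l j) (a t) u) ⟩
      lincomb (a j) u ⊕ (l j · lincomb (a t) u)  ≡⟨ cong₂ (λ x y → x ⊕ (l j · y)) (proj₂ (rows exp j j∈J))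
                                                                               (proj₂ (rows exp t t∈J)) ⟩
      v j ⊕ (l j · v t)                          ∎

  pivot-cancels : ∀ x {α α⁻¹} → α * α⁻¹ ≡ 1# → x + (- (x * α⁻¹)) * α ≡ 0#
  pivot-cancels x {α} {α⁻¹} αα⁻¹≡1 = begin
    x + (- (x * α⁻¹)) * α    ≡⟨ cong (x +_) (-‿distribˡ-* (x * α⁻¹) α) ⟨
    x + - ((x * α⁻¹) * α)    ≡⟨ cong (λ y → x + - y) (*-assoc x α⁻¹ α) ⟩
    x + - (x * (α⁻¹ * α))    ≡⟨ cong (λ y → x + - (x * y)) (trans (*-comm α⁻¹ α) αα⁻¹≡1) ⟩
    x + - (x * 1#)           ≡⟨ cong (λ y → x + - y) (*-identityʳ x) ⟩
    x + - x                  ≡⟨ -‿inverseʳ x ⟩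
    0#                       ∎
    where open ≡-Reasoning

  -- Pick i ∈ I.  If some row t ∈ J has a nonzero i-th coefficient, subtract multiples
  -- of row t to clear coordinate i from the other rows and recurse on J - t over I - i; otherwise drop i.
  steinitz : ∀ k {r N N'} {a : Fin N' → Vec F N} {u : Fin N → Vec F r} {I v J} →
             ∣ I ∣ ≤ k → Indep v J → Expresses a u I v J → ∣ J ∣ ≤ ∣ I ∣
  steinitz k {I = I} ∣I∣≤k ind exp with nonempty? I
  ... | no I-empty = subst (_≤ ∣ I ∣) (sym (Expresses-over-∅ ind exp (λ i i∈I → I-empty (i , i∈I)))) z≤n
  steinitz zero {I = I} ∣I∣≤0 ind exp | yes (i , i∈I) with () ← ℕ.≤-trans (x∈p⇒∣p-x∣<∣p∣ i∈I) ∣I∣≤0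
  steinitz (suc k) {a = a} {I = I} {J = J} ∣I∣≤1+k ind exp | yes (i , i∈I) = pivot
    where
    ∣I-i∣≤k : ∣ I - i ∣ ≤ k
    ∣I-i∣≤k = ℕ.≤-pred (ℕ.≤-trans (x∈p⇒∣p-x∣<∣p∣ i∈I) ∣I∣≤1+k)

    pivot : ∣ J ∣ ≤ ∣ I ∣
    pivot with any? (λ j → (j ∈? J) ×-dec ¬? (lookup (a j) i ≟F 0#))
    ... | no no-pivot = ℕ.≤-trans (steinitz k ∣I-i∣≤k ind (Expresses-drop exp aᵢ≡0)) (∣p─q∣≤∣p∣ I ⁅ i ⁆)
      where
      aᵢ≡0 : ∀ j → j ∈ J → lookup (a j) i ≡ 0#
      aᵢ≡0 j j∈J with lookup (a j) i ≟F 0#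
      ... | yes aⱼᵢ≡0 = aⱼᵢ≡0
      ... | no aⱼᵢ≢0  = ⊥-elim (no-pivot (j , j∈J , aⱼᵢ≢0))
    ... | yes (t , t∈J , α≢0) with inverse (lookup (a t) i) α≢0
    ...   | α⁻¹ , αα⁻¹≡1 = begin
      ∣ J ∣          ≡⟨ ∣p∣≡1+∣p-x∣ t∈J ⟩
      suc ∣ J - t ∣  ≤⟨ s≤s (steinitz k ∣I-i∣≤k (Indep-shear l t∈J ind)
                                               (Expresses-eliminate exp t∈J l cancels)) ⟩
      suc ∣ I - i ∣  ≡⟨ ∣p∣≡1+∣p-x∣ i∈I ⟨
      ∣ I ∣          ∎
      where
      open ℕ.≤-Reasoning
      l : _ → F
      l j = - (lookup (a j) i * α⁻¹)
      cancels : ∀ j → lookup (a j) i + l j * lookup (a t) i ≡ 0#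
      cancels j = pivot-cancels (lookup (a j) i) αα⁻¹≡1

  ∈-allSubsets : ∀ {n} (Y : Subset n) → Y ∈ₗ allSubsets n
  ∈-allSubsets []                    = here refl
  ∈-allSubsets {suc n} (outside ∷ Y) = ∈ₗ-++⁺ˡ (∈-map⁺ (outside ∷_) (∈-allSubsets Y))
  ∈-allSubsets {suc n} (inside ∷ Y)  =
    ∈ₗ-++⁺ʳ (List.map (outside ∷_) (allSubsets n)) (∈-map⁺ (inside ∷_) (∈-allSubsets Y))

  ∈⇒≤maxL : ∀ {x} xs → x ∈ₗ xs → x ≤ maxL xs
  ∈⇒≤maxL (y List.∷ xs) (here refl) = ℕ.m≤m⊔n y (maxL xs)
  ∈⇒≤maxL (y List.∷ xs) (there x∈)  = ℕ.≤-trans (∈⇒≤maxL xs x∈) (ℕ.m≤n⊔m y (maxL xs))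

  -- Definitionally the filter in the definition of rank.
  IndepIn? : ∀ {r n} (v : Fin n → Vec F r) (X Y : Subset n) → Dec (Y ⊆ X × Indep v Y)
  IndepIn? v X Y = (Y ⊆? X) ×-dec indep? v Y

  Indep⇒≤rank : ∀ {r n} {v : Fin n → Vec F r} {X Y} → Y ⊆ X → Indep v Y → ∣ Y ∣ ≤ rank v X
  Indep⇒≤rank {v = v} {X} {Y} Y⊆X ind =
    ∈⇒≤maxL _ (∈-map⁺ ∣_∣ (∈-filter⁺ (IndepIn? v X) (∈-allSubsets Y) (Y⊆X , ind)))

  record Basis {r n} (v : Fin n → Vec F r) (X : Subset n) : Set where
    field
      indices        : Subset n
      ⊆X             : indices ⊆ X
      independent    : Indep v indices
      ∣indices∣≡rank : ∣ indices ∣ ≡ rank v X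
  open Basis

  basis : ∀ {r n} (v : Fin n → Vec F r) X → Basis v X
  basis {n = n} v X with foldr-selective ℕ.⊔-sel 0 (List.map ∣_∣ (filter (IndepIn? v X) (allSubsets n)))
  ... | inj₁ rank≡0 = record
    { indices = ⊥ ; ⊆X = ⊥⊆ ; independent = λ c supp _ i → supp i ∉⊥
    ; ∣indices∣≡rank = trans (∣⊥∣≡0 n) (sym rank≡0) }
  ... | inj₂ rank∈ with ∈-map⁻ ∣_∣ rank∈
  ...   | Y , Y∈ , rank≡∣Y∣ with ∈-filter⁻ (IndepIn? v X) {xs = allSubsets n} Y∈
  ...     | _ , Y⊆X , ind = record
    { indices = Y ; ⊆X = Y⊆X ; independent = ind ; ∣indices∣≡rank = sym rank≡∣Y∣ }

  -- A basis is an independent subset of maximum size, so no element of X extends it.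
  basis-spans : ∀ {r n} {v : Fin n → Vec F r} {X} (B : Basis v X) → ∀ x → x ∈ X → InSpan v (indices B) (v x)
  basis-spans {v = v} {X} B x x∈X with inSpan? v (indices B) (v x)
  ... | yes in-span = in-span
  ... | no ¬in-span = ⊥-elim (ℕ.<-irrefl (∣indices∣≡rank B) larger)
    where
    x∉B : x ∉ indices B
    x∉B x∈B = ¬in-span (unitVec x , unitVec-supported x∈B , lincomb-unitVec x v)
    B∪x⊆X : indices B ∪ ⁅ x ⁆ ⊆ X
    B∪x⊆X {i} i∈ = [ ⊆X B , (λ i∈⁅x⁆ → subst (_∈ X) (sym (x∈⁅y⁆⇒x≡y x i∈⁅x⁆)) x∈X) ]′
                     (x∈p∪q⁻ (indices B) ⁅ x ⁆ i∈)
    larger : suc ∣ indices B ∣ ≤ rank v X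
    larger = subst (_≤ rank v X) (∣p∪⁅x⁆∣≡1+∣p∣ x∉B)
                   (Indep⇒≤rank B∪x⊆X (Indep-∪⁅⁆ (independent B) ¬in-span))

  InClosure⇒InSpan : ∀ {r n} {v : Fin n → Vec F r} {Q p} → InClosure v Q p → InSpan v Q p
  InClosure⇒InSpan {v = v} {Q} {p} closure with basis v Q
  ... | B with inSpan? v (indices B) p
  ...   | yes in-span = InSpan-mono (⊆X B) in-span
  ...   | no ¬in-span = ⊥-elim (ℕ.<-irrefl (∣indices∣≡rank B) (ℕ.≤-trans larger (ℕ.≤-reflexive closure)))
    where
    larger : suc ∣ indices B ∣ ≤ rank (p VF.∷ v) (inside ∷ Q)
    larger = Indep⇒≤rank (λ { here → here ; (there i∈B) → there (⊆X B i∈B) })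
                         (Indep-∷ (independent B) ¬in-span)

  rank≤∣spanning∣ : ∀ {r n} {v : Fin n → Vec F r} {W I} →
                    (∀ j → j ∈ W → InSpan v I (v j)) → rank v W ≤ ∣ I ∣
  rank≤∣spanning∣ {v = v} {W} {I} spanned with basis v W | coefficients spanned
  ... | B | a , a-spans = subst (_≤ ∣ I ∣) (∣indices∣≡rank B)
    (steinitz ∣ I ∣ ℕ.≤-refl (independent B)
              (expresses {a = a} {u = v} λ j j∈B → proj₁ (a-spans j) , proj₂ (a-spans j) (⊆X B j∈B)))

  Indep-++ : ∀ {r n m} {e : Fin n → Vec F r} (s : Fin m → Vec F r) {Y} →
             Indep e Y → Indep (e ++ s) (Y Vec.++ ⊥)
  Indep-++ {n = n} {m} {e} s {Y} ind c supp eq with Vec.splitAt n c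
  ... | c₁ , c₂ , refl = c≡0
    where
    open ≡-Reasoning
    c₂≡0 : ∀ j → lookup c₂ j ≡ 0#
    c₂≡0 j = trans (sym (lookup-++ʳ c₁ c₂ j)) (supp (n ↑ʳ j) (∉⊥ ∘ ∈-++⁻ʳ Y))
    c₂≡0v : c₂ ≡ 0v
    c₂≡0v = lookup-extensionality λ j → trans (c₂≡0 j) (sym (lookup-0v j))
    c₁-supported : SupportedIn c₁ Y
    c₁-supported x x∉Y = trans (sym (lookup-++ˡ c₁ c₂ x)) (supp (x ↑ˡ m) (x∉Y ∘ ∈-++⁻ˡ Y))
    c₁-relation : lincomb c₁ e ≡ 0v
    c₁-relation = begin
      lincomb c₁ e                     ≡⟨ ⊕-identityʳ _ ⟨
      lincomb c₁ e ⊕ 0v                ≡⟨ cong (lincomb c₁ e ⊕_) (lincomb-0v-coeffs s) ⟨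
      lincomb c₁ e ⊕ lincomb 0v s      ≡⟨ cong (λ d → lincomb c₁ e ⊕ lincomb d s) c₂≡0v ⟨
      lincomb c₁ e ⊕ lincomb c₂ s      ≡⟨ lincomb-++ c₁ c₂ e s ⟨
      lincomb (c₁ Vec.++ c₂) (e ++ s)  ≡⟨ eq ⟩
      0v                               ∎
    c≡0 : ∀ i → lookup (c₁ Vec.++ c₂) i ≡ 0#
    c≡0 i with ↑-view n i
    ... | left x  = trans (lookup-++ˡ c₁ c₂ x) (ind c₁ c₁-supported c₁-relation x)
    ... | right j = trans (lookup-++ʳ c₁ c₂ j) (c₂≡0 j)

  InSpan-++ : ∀ {r n m} {e : Fin n → Vec F r} (s : Fin m → Vec F r) {I p} →
              InSpan e I p → InSpan (e ++ s) (I Vec.++ ⊥) p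
  InSpan-++ {n = n} {e = e} s {I} {p} (c , supp , c≡p) = c Vec.++ 0v , supported , (begin
    lincomb (c Vec.++ 0v) (e ++ s)  ≡⟨ lincomb-++ c 0v e s ⟩
    lincomb c e ⊕ lincomb 0v s      ≡⟨ cong (lincomb c e ⊕_) (lincomb-0v-coeffs s) ⟩
    lincomb c e ⊕ 0v                ≡⟨ ⊕-identityʳ _ ⟩
    lincomb c e                     ≡⟨ c≡p ⟩
    p                               ∎)
    where
    open ≡-Reasoning
    supported : SupportedIn (c Vec.++ 0v) (I Vec.++ ⊥)
    supported i i∉ with ↑-view n i
    ... | left x  = trans (lookup-++ˡ c 0v x) (supp x (i∉ ∘ ∈-++⁺ˡ))
    ... | right j = trans (lookup-++ʳ c 0v j) (lookup-0v j)

  rank≤rank-++ : ∀ {r n m} (e : Fin n → Vec F r) (s : Fin m → Vec F r) X Z →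
                 rank e X ≤ rank (e ++ s) (X Vec.++ Z)
  rank≤rank-++ e s X Z with basis e X
  ... | B = subst (_≤ rank (e ++ s) (X Vec.++ Z)) (trans (∣p++⊥∣≡∣p∣ (indices B)) (∣indices∣≡rank B))
                  (Indep⇒≤rank (++-mono-⊆ (⊆X B) ⊥⊆) (Indep-++ s (independent B)))

  rank-++≤rank : ∀ {r n m} (e : Fin n → Vec F r) (s : Fin m → Vec F r) X Z →
                 (∀ j → j ∈ Z → InSpan e X (s j)) → rank (e ++ s) (X Vec.++ Z) ≤ rank e X
  rank-++≤rank {n = n} e s X Z s-spanned with basis e X
  ... | B = subst (rank (e ++ s) (X Vec.++ Z) ≤_) (trans (∣p++⊥∣≡∣p∣ (indices B)) (∣indices∣≡rank B))
                  (rank≤∣spanning∣ spanned)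
    where
    spanned : ∀ i → i ∈ X Vec.++ Z → InSpan (e ++ s) (indices B Vec.++ ⊥) ((e ++ s) i)
    spanned i i∈ with ↑-view n i
    ... | left x  = subst (InSpan _ _) (sym (VF.lookup-++ˡ e s x))
                      (InSpan-++ s (basis-spans B x (∈-++⁻ˡ X i∈)))
    ... | right j = subst (InSpan _ _) (sym (VF.lookup-++ʳ e s j))
                      (InSpan-++ s (InSpan-trans (basis-spans B) (s-spanned j (∈-++⁻ʳ X i∈))))

  rankM-++ : ∀ {r n m} (e : Fin n → Vec F r) (s : Fin m → Vec F r) →
             (∀ j → InSpan e ⊤ (s j)) → rankM (e ++ s) ≡ rankM e
  rankM-++ {n = n} {m} e s s-spanned = begin
    rank (e ++ s) ⊤                     ≡⟨ cong (rank (e ++ s)) (⊤≡⊤++⊤ {n} {m}) ⟩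
    rank (e ++ s) (⊤ {n} Vec.++ ⊤ {m})  ≡⟨ ℕ.≤-antisym (rank-++≤rank e s ⊤ ⊤ (λ j _ → s-spanned j))
                                                       (rank≤rank-++ e s ⊤ ⊤) ⟩
    rank e ⊤                            ∎
    where open ≡-Reasoning

module RootedTree (T : Tree) where
  open Tree T
  open TreeOps T
  open DecMembership (_≟ᶠ_ {suc k}) using () renaming (_∈?_ to _∈ₗ?_)

  infix 4 _≼_ _≼?_

  data _≼_ : V → V → Set where
    ≼-refl : ∀ {w} → w ≼ w
    ≼-step : ∀ {a i} → a ≼ par i → a ≼ suc i

  ≼-trans : ∀ {a b c} → a ≼ b → b ≼ c → a ≼ c
  ≼-trans a≼b ≼-refl       = a≼b
  ≼-trans a≼b (≼-step b≼c) = ≼-step (≼-trans a≼b b≼c)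

  ≼-comparable : ∀ {a b w} → a ≼ w → b ≼ w → a ≼ b ⊎ b ≼ a
  ≼-comparable ≼-refl       b≼w          = inj₂ b≼w
  ≼-comparable (≼-step a≼w) ≼-refl       = inj₁ (≼-step a≼w)
  ≼-comparable (≼-step a≼w) (≼-step b≼w) = ≼-comparable a≼w b≼w

  ∈ancestors⇒≼ : ∀ fuel {a w} → a ∈ₗ ancestors fuel w → a ≼ w
  ∈ancestors⇒≼ zero                   (here refl) = ≼-refl
  ∈ancestors⇒≼ (suc fuel) {w = zero}  (here refl) = ≼-refl
  ∈ancestors⇒≼ (suc fuel) {w = suc i} (here refl) = ≼-refl
  ∈ancestors⇒≼ (suc fuel) {w = suc i} (there a∈)  = ≼-step (∈ancestors⇒≼ fuel a∈)

  ≼⇒∈ancestors : ∀ fuel {a w} → a ≼ w → toℕ w ≤ fuel → a ∈ₗ ancestors fuel w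
  ≼⇒∈ancestors zero                   ≼-refl _ = here refl
  ≼⇒∈ancestors (suc fuel) {w = zero}  ≼-refl _ = here refl
  ≼⇒∈ancestors (suc fuel) {w = suc i} ≼-refl _ = here refl
  ≼⇒∈ancestors (suc fuel) (≼-step {i = i} a≼par) (s≤s i≤fuel) =
    there (≼⇒∈ancestors fuel a≼par (ℕ.≤-trans (par< i) i≤fuel))

  _≼?_ : ∀ a w → Dec (a ≼ w)
  a ≼? w = map′ (∈ancestors⇒≼ (suc k)) (λ a≼w → ≼⇒∈ancestors (suc k) a≼w (toℕ≤n w))
                (a ∈ₗ? ancestors (suc k) w)

  below-reflects : ∀ {a w b} → below a w ≡ b → Reflects (a ≼ w) b
  below-reflects {a} {w} refl = proof (a ≼? w)

  data Position (u : V) (C : V → Bool) : Set where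
    contains-u      : C u ≡ true → Position u C
    outside-subtree : (∀ {w} → C w ≡ true → ¬ u ≼ w) → Position u C
    inside-subtree  : (∀ {w} → C w ≡ true → u ≼ w) → Position u C

  subtree-position : ∀ u c → Position u (below c)
  subtree-position u c with c ≼? u | u ≼? c
  ... | yes c≼u | _       = contains-u (dec-true (c ≼? u) c≼u)
  ... | no _    | yes u≼c = inside-subtree λ c≼w → ≼-trans u≼c (invert (below-reflects c≼w))
  ... | no c⋠u  | no u⋠c  = outside-subtree λ c≼w u≼w →
    [ c⋠u , u⋠c ]′ (≼-comparable (invert (below-reflects c≼w)) u≼w)

  cosubtree-position : ∀ u v → Position u (not ∘ below v)
  cosubtree-position u v with v ≼? u
  ... | no v⋠u  = contains-u (cong not (dec-false (v ≼? u) v⋠u))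
  ... | yes v≼u = outside-subtree λ v⋠w u≼w →
    invert (below-reflects (not-injective {y = false} v⋠w)) (≼-trans v≼u u≼w)

  components-positioned : ∀ u v → All (Position u) (components v)
  components-positioned u zero    = ++⁺ (map⁺ (All.universal (subtree-position u) _)) []
  components-positioned u (suc v) =
    ++⁺ (map⁺ (All.universal (subtree-position u) _)) (cosubtree-position u (suc v) All.∷ [])

module TreeWidth {q : ℕ} (𝔽 : FiniteField q) where
  open GF 𝔽
  open LinearAlgebra 𝔽
  open TreeDec
  open RootedTree
    using (Position; contains-u; outside-subtree; inside-subtree; below-reflects; components-positioned)

  maxL-mono-≤ : ∀ {A : Set} {f g : A → ℕ} xs → (∀ x → f x ≤ g x) →
                maxL (List.map f xs) ≤ maxL (List.map g xs)
  maxL-mono-≤ List.[]       f≤g = z≤n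
  maxL-mono-≤ (x List.∷ xs) f≤g = ℕ.⊔-mono-≤ (f≤g x) (maxL-mono-≤ xs f≤g)

  decomposition : ∀ {n} (T : Tree) → (Fin n → Fin (suc (Tree.k T))) → TreeDec n
  decomposition T τ = record { tree = T ; τ = τ }

  restrict : ∀ {n} m → TreeDec (n ℕ.+ m) → TreeDec n
  restrict m D = decomposition (tree D) (τ D ∘ (_↑ˡ m))

  extend : ∀ {n} m (D : TreeDec n) → Fin (suc (Tree.k (tree D))) → TreeDec (n ℕ.+ m)
  extend m D u = decomposition (tree D) (τ D ++ λ _ → u)

  complement-preimage-++ : ∀ {n m} (D : TreeDec (n ℕ.+ m)) C →
    complement 𝔽 (preimage 𝔽 D C) ≡
    complement 𝔽 (preimage 𝔽 (restrict m D) C) Vec.++ complement 𝔽 (tabulate (C ∘ τ D ∘ (n ↑ʳ_)))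
  complement-preimage-++ {n} {m} D C =
    trans (cong (complement 𝔽) (tabulate-++ {n = n} {m} (C ∘ τ D)))
          (map-++ not (tabulate (C ∘ τ D ∘ (_↑ˡ m))) (tabulate (C ∘ τ D ∘ (n ↑ʳ_))))

  -- Node width is r(M) minus a sum of rank defects r(M) - r(E - B), so it grows with the ranks r(E - B).
  width-mono : ∀ {r n₁ n₂} {e₁ : Fin n₁ → Vec F r} {e₂ : Fin n₂ → Vec F r} (T : Tree) {τ₁ τ₂}
               {P : (Fin (suc (Tree.k T)) → Bool) → Set} → (∀ v → All P (TreeOps.components T v)) →
               rankM e₁ ≡ rankM e₂ →
               (∀ {C} → P C → rank e₁ (complement 𝔽 (preimage 𝔽 (decomposition T τ₁) C))
                            ≤ rank e₂ (complement 𝔽 (preimage 𝔽 (decomposition T τ₂) C))) →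
               width 𝔽 e₁ (decomposition T τ₁) ≤ width 𝔽 e₂ (decomposition T τ₂)
  width-mono {e₁ = e₁} {e₂} T all-P rank≡ rank≤ = maxL-mono-≤ (List.allFin _) node-width≤
    where
    node-width≤ : ∀ v → nodeWidth 𝔽 e₁ _ v ≤ nodeWidth 𝔽 e₂ _ v
    node-width≤ v = ℕ.∸-mono (ℕ.≤-reflexive rank≡)
                      (foldr-+-mono-≤ (all-P v) (ℕ.∸-mono (ℕ.≤-reflexive (sym rank≡)) ∘ rank≤))

  width-restrict≤ : ∀ {r n m} (e : Fin n → Vec F r) (s : Fin m → Vec F r) → rankM e ≡ rankM (e ++ s) →
                    ∀ D → width 𝔽 e (restrict m D) ≤ width 𝔽 (e ++ s) D
  width-restrict≤ {n = n} {m} e s rank≡ D =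
    width-mono (tree D) {τ D ∘ (_↑ˡ m)} {τ D} (λ v → All.universal (λ _ → tt) _) rank≡ λ {C} _ →
      subst (λ Y → rank e (complement 𝔽 (preimage 𝔽 (restrict m D) C)) ≤ rank (e ++ s) Y)
            (sym (complement-preimage-++ {n} {m} D C)) (rank≤rank-++ e s _ _)

  InNeck⇒InSpan-complement : ∀ {r n} {e : Fin n → Vec F r} {D : TreeDec n} {i p C} →
                             Position (tree D) (suc i) C → C (suc i) ≡ false → InNeck 𝔽 e D i p →
                             InSpan e (complement 𝔽 (preimage 𝔽 D C)) p
  InNeck⇒InSpan-complement (contains-u Cu≡true) Cu≡false _ with () ← trans (sym Cu≡true) Cu≡false
  InNeck⇒InSpan-complement {D = D} {i} {C = C} (outside-subtree avoids) _ (in-child-side , _) =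
    InSpan-mono child-side⊆ (InClosure⇒InSpan in-child-side)
    where
    child-side⊆ : preimage 𝔽 D (TreeOps.childSide (tree D) i) ⊆ complement 𝔽 (preimage 𝔽 D C)
    child-side⊆ x∈ = ∈-map-not-tabulate⁺ λ Cx≡true →
      avoids Cx≡true (invert (below-reflects (tree D) (∈-tabulate⁻ x∈)))
  InNeck⇒InSpan-complement {D = D} {i} {C = C} (inside-subtree within) _ (_ , in-parent-side) =
    InSpan-mono parent-side⊆ (InClosure⇒InSpan in-parent-side)
    where
    parent-side⊆ : preimage 𝔽 D (TreeOps.parentSide' (tree D) i) ⊆ complement 𝔽 (preimage 𝔽 D C)
    parent-side⊆ x∈ = ∈-map-not-tabulate⁺ λ Cx≡true →
      invert (below-reflects (tree D) (not-injective {y = false} (∈-tabulate⁻ x∈))) (within Cx≡true)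

  width-extend≤ : ∀ {r n m} (e : Fin n → Vec F r) (s : Fin m → Vec F r) (D : TreeDec n) i →
                  rankM (e ++ s) ≡ rankM e → (∀ j → InNeck 𝔽 e D i (s j)) →
                  width 𝔽 (e ++ s) (extend m D (suc i)) ≤ width 𝔽 e D
  width-extend≤ {n = n} {m} e s D i rank≡ neck =
    width-mono (tree D) {τ D ++ λ _ → suc i} {τ D} (components-positioned (tree D) (suc i)) rank≡ rank≤
    where
    rank≤ : ∀ {C} → Position (tree D) (suc i) C →
            rank (e ++ s) (complement 𝔽 (preimage 𝔽 (extend m D (suc i)) C))
              ≤ rank e (complement 𝔽 (preimage 𝔽 D C))
    rank≤ {C} position = subst (λ Y → rank (e ++ s) Y ≤ rank e X) (sym split) (rank-++≤rank e s X Z spanned)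
      where
      X = complement 𝔽 (preimage 𝔽 D C)
      Z = complement 𝔽 (tabulate (C ∘ τ (extend m D (suc i)) ∘ (n ↑ʳ_)))
      split : complement 𝔽 (preimage 𝔽 (extend m D (suc i)) C) ≡ X Vec.++ Z
      split = trans (complement-preimage-++ {n} {m} (extend m D (suc i)) C)
                    (cong (λ Y → complement 𝔽 Y Vec.++ Z)
                          (tabulate-cong λ x → cong C (VF.lookup-++ˡ (τ D) _ x)))
      spanned : ∀ j → j ∈ Z → InSpan e X (s j)
      spanned j j∈Z = InNeck⇒InSpan-complement position
        (trans (cong C (sym (VF.lookup-++ʳ (τ D) _ j))) (∈-map-not-tabulate⁻ j∈Z)) (neck j)

open import Data.Nat using (_+_)

lemma3p6 : (q : ℕ) → IsPrimePower q → (𝔽 : FiniteField q) →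
    let open GF 𝔽 in
    (r n : ℕ) (e : Fin n → Vec F r) →
    (∀ x → Normalized (e x)) → (∀ x y → e x ≡ e y → x ≡ y) → rankM e ≡ r →
    (D : TreeDec n) → (∀ (D' : TreeDec n) → width 𝔽 e D ≤ width 𝔽 e D') →
    (m : ℕ) (s : Fin m → Vec F r) →
    (∀ j → Normalized (s j)) → (∀ j j' → s j ≡ s j' → j ≡ j') →
    (i : Fin (Tree.k (TreeDec.tree D))) → (∀ j → InExternalNeck 𝔽 e D i (s j)) →
    (∃[ D' ] (width 𝔽 (e ++ s) D' ≡ width 𝔽 e D)) ×
    (∀ (D' : TreeDec (n + m)) → width 𝔽 e D ≤ width 𝔽 (e ++ s) D')
lemma3p6 q _ 𝔽 r n e _ _ _ D optimal m s _ _ i external-neck =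
  (extend m D (suc i) , ℕ.≤-antisym upper (lower (extend m D (suc i)))) , lower
  where
  open GF 𝔽 using (rankM)
  open LinearAlgebra 𝔽 using (InSpan-mono; InClosure⇒InSpan; rankM-++)
  open TreeWidth 𝔽 using (restrict; extend; width-restrict≤; width-extend≤)

  neck : ∀ j → InNeck 𝔽 e D i (s j)
  neck j = proj₁ (external-neck j)

  rank≡ : rankM (e ++ s) ≡ rankM e
  rank≡ = rankM-++ e s λ j → InSpan-mono (λ _ → ∈⊤) (InClosure⇒InSpan (proj₁ (neck j)))

  lower : ∀ D′ → width 𝔽 e D ≤ width 𝔽 (e ++ s) D′
  lower D′ = ℕ.≤-trans (optimal (restrict m D′)) (width-restrict≤ e s (sym rank≡) D′)

  upper : width 𝔽 (e ++ s) (extend m D (suc i)) ≤ width 𝔽 e D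
  upper = width-extend≤ e s D i rank≡ neck
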